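{- Let $G'$ be a connected graph with two distinct vertices $v_1,v_2$, let $P$ be a path with distinct ends $u_1,u_2$ vertex-disjoint from $G'$, and let $G$ be obtained from $G'$ and $P$ by identifying $u_i$ with $v_i$ for $i=1,2$. Let $X=X_0\cup X'$ with $X_0\subseteq E(P)$ and $X'\subseteq E(G')$. Then: (i) if $|E(P)|$ is odd and $X$ is non-feasible in $G$, then $X'$ is non-feasible in $G'$; (ii) if $|X_0|$ is even, then $X\sim_G X'$; (iii) if $|X_0|$ is odd, then $X\sim_G X'\cup\{e\}$ for every $e\in E(P)$; (iv) if $X'\sim_{G'} Y$, then $X\sim_G Y\cup Y_0$ for some $Y_0\subseteq E(P)$; (v) if $X'\sim_{G'}\emptyset$, then either $X\sim_G\emptyset$ or $X\sim_G\{e\}$ for every $e\in E(P)$; (vi) if $X'\sim_{G'}E(G')$, then either $X\sim_G E(G)$ or $X\sim_G E(G)-\{e\}$ for every $e\in E(P)$; (vii) if $X\sim_G\emptyset$ then $X'\sim_{G'}\emptyset$; if $X\sim_G E(G)$ then $X'\sim_{G'}E(G')$.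
   Context: Graphs are finite, undirected, loopless. For a graph $H$, $X\subseteq E(H)$ is feasible in $H$ if there are perfect matchings $M_1,M_2$ of $H$ with $|M_1\cap X|\not\equiv|M_2\cap X|\pmod 2$, and non-feasible otherwise. $\nabla_H(U)$ is the set of edges with exactly one end in $U\subseteq V(H)$; $X\sim_H Y$ means $X=Y\oplus\nabla_H(U)$ for some $U\subseteq V(H)$ ($\oplus$ = symmetric difference). -}

module Defs where

open import Data.Nat using (ℕ; zero; suc; _+_; _%_)
open import Data.Fin using (Fin; zero; suc; _↑ˡ_; _↑ʳ_; splitAt; inject₁)
open import Data.Fin.Properties using (_≟_)
open import Data.Bool using (Bool; true; false; _∧_; _∨_; _xor_; not; if_then_else_)
open import Data.Product using (_×_; _,_; proj₁; proj₂; ∃; ∃-syntax)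
open import Data.Sum using (_⊎_; inj₁; inj₂; [_,_])
open import Data.Unit using (⊤; tt)
open import Relation.Nullary using (¬_; ⌊_⌋)
open import Relation.Binary.PropositionalEquality using (_≡_; _≢_)

record Graph : Set where
  field
    nV : ℕ
    nE : ℕ
    ends : Fin nE → Fin nV × Fin nV
open Graph public

Loopless : Graph → Set
Loopless G = ∀ e → proj₁ (ends G e) ≢ proj₂ (ends G e)

EdgeSet : Graph → Set
EdgeSet G = Fin (nE G) → Bool

VertexSet : Graph → Set
VertexSet G = Fin (nV G) → Bool

count : ∀ {m} → (Fin m → Bool) → ℕ
count {zero} f = 0
count {suc m} f = (if f zero then 1 else 0) + count (λ i → f (suc i))

incident : (G : Graph) → Fin (nV G) → Fin (nE G) → Bool
incident G v e = ⌊ proj₁ (ends G e) ≟ v ⌋ ∨ ⌊ proj₂ (ends G e) ≟ v ⌋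

IsPerfectMatching : (G : Graph) → EdgeSet G → Set
IsPerfectMatching G M = ∀ v → count (λ e → M e ∧ incident G v e) ≡ 1

Feasible : (G : Graph) → EdgeSet G → Set
Feasible G X = ∃[ M₁ ] ∃[ M₂ ] (IsPerfectMatching G M₁ × IsPerfectMatching G M₂
  × (count (λ e → M₁ e ∧ X e) % 2 ≢ count (λ e → M₂ e ∧ X e) % 2))

NonFeasible : (G : Graph) → EdgeSet G → Set
NonFeasible G X = ¬ Feasible G X

cut : (G : Graph) → VertexSet G → EdgeSet G
cut G U e = U (proj₁ (ends G e)) xor U (proj₂ (ends G e))

Equiv : (G : Graph) → EdgeSet G → EdgeSet G → Set
Equiv G X Y = ∃[ U ] (∀ e → X e ≡ (Y e xor cut G U e))

data Reach (G : Graph) : Fin (nV G) → Fin (nV G) → Set where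
  here : ∀ {u} → Reach G u u
  stepF : ∀ {u w} e → proj₁ (ends G e) ≡ u → Reach G (proj₂ (ends G e)) w → Reach G u w
  stepB : ∀ {u w} e → proj₂ (ends G e) ≡ u → Reach G (proj₁ (ends G e)) w → Reach G u w

Connected : Graph → Set
Connected G = ∀ u v → Reach G u v

∅ : (G : Graph) → EdgeSet G
∅ G e = false

allE : (G : Graph) → EdgeSet G
allE G e = true

-- Gluing a path with suc l edges onto G' (n vertices, m edges) at v₁, v₂.
-- Path vertices p₀ … p_{l+1}; p₀ = v₁, p_{l+1} = v₂, the l inner vertices
-- are new vertices n ↑ʳ i.  Path edge j joins p_j and p_{j+1}.
-- Edges of G: G' edges (e ↑ˡ suc l) followed by path edges (m ↑ʳ j).

lastOr : ∀ {l} → Fin (suc l) → Fin l ⊎ ⊤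
lastOr {zero} zero = inj₂ tt
lastOr {suc l} zero = inj₁ zero
lastOr {suc l} (suc i) with lastOr {l} i
... | inj₁ k = inj₁ (suc k)
... | inj₂ t = inj₂ t

pathVtx : (n l : ℕ) → Fin n → Fin n → Fin (suc (suc l)) → Fin (n + l)
pathVtx n l v₁ v₂ zero = v₁ ↑ˡ l
pathVtx n l v₁ v₂ (suc i) = [ (λ k → n ↑ʳ k) , (λ _ → v₂ ↑ˡ l) ] (lastOr i)

glue : (G' : Graph) → Fin (nV G') → Fin (nV G') → (l : ℕ) → Graph
glue G' v₁ v₂ l = record
  { nV = nV G' + l
  ; nE = nE G' + suc l
  ; ends = λ e → [ (λ e' → (proj₁ (ends G' e') ↑ˡ l) , (proj₂ (ends G' e') ↑ˡ l))
                 , (λ j → pathVtx (nV G') l v₁ v₂ (inject₁ j) , pathVtx (nV G') l v₁ v₂ (suc j)) ]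
                 (splitAt (nE G') e)
  }

joinE : (G' : Graph) (v₁ v₂ : Fin (nV G')) (l : ℕ)
      → EdgeSet G' → (Fin (suc l) → Bool) → EdgeSet (glue G' v₁ v₂ l)
joinE G' v₁ v₂ l X' X₀ e = [ X' , X₀ ] (splitAt (nE G') e)

single : ∀ {l} → Fin (suc l) → Fin (suc l) → Bool
single j i = ⌊ i ≟ j ⌋

-- A vertex set U' of G' extends to G along P by labelling the path vertices with running
-- parities: starting from U'(v₁) and flipping at every edge of a prescribed Z ⊆ E(P), the cut
-- of the labelling is Z on E(P), and the labelling ends in U'(v₂) exactly when
-- |Z| ≡ U'(v₁) + U'(v₂) (mod 2).  So X' ⊕ Y' = ∇(U') lifts to X₀ ∪ X' ∼ Y₀ ∪ Y' whenever
-- |X₀ ⊕ Y₀| has that parity, and flipping one path edge of Y₀ flips the parity; this gives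
-- (ii)–(vi), while (vii) is restriction of U to V(G').  For (i): when |E(P)| is odd, adding every
-- second edge of P (the first and last are skipped) to a perfect matching of G' yields one of G,
-- and changes |M ∩ X| by an amount independent of M.

module Submission where

open import Defs
open import Data.Nat using (ℕ; zero; suc; _+_; _*_; _%_; NonZero)
open import Data.Nat.Properties using (+-assoc; +-identityʳ; *-suc)
open import Data.Nat.DivMod using (%-distribˡ-+; [m+kn]%n≡m%n)
open import Data.Bool using (Bool; true; false; not; _∧_; _∨_; _xor_; if_then_else_)
open import Data.Bool.Properties
  using (not-involutive; xor-assoc; xor-comm; xor-same; xor-identityʳ; not-distribʳ-xor
        ; xor-∧-commutativeRing; ¬-not; ∨-zeroʳ; ∧-zeroʳ; ∧-conicalˡ; ∧-conicalʳ; T-≡)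
import Data.Bool.Properties as Bool
open import Data.Fin using (Fin; zero; suc; _↑ˡ_; _↑ʳ_; splitAt; inject₁; fromℕ)
open import Data.Fin.Properties
  using (_≟_; 0≢1+n; suc-injective; ↑ˡ-injective; ↑ʳ-injective; inject₁-injective
        ; fromℕ≢inject₁; splitAt-↑ˡ; splitAt-↑ʳ)
open import Data.Fin.Relation.Unary.Top using (view; ‵fromℕ; ‵inject₁)
open import Data.Product using (_×_; _,_; proj₁; proj₂; ∃-syntax)
open import Data.Sum using (_⊎_; inj₁; inj₂; [_,_]; map₁)
open import Data.Unit using (tt)
open import Data.Empty using (⊥-elim)
open import Function using (_∘_; case_of_)
open import Function.Bundles using (_⇔_; mk⇔; Equivalence)
open import Algebra.Bundles using (CommutativeRing)
import Algebra.Properties.CommutativeSemigroup as CommutativeSemigroupProperties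
open import Relation.Nullary using (Dec; yes; no; ¬_; ⌊_⌋)
open import Relation.Nullary.Decidable using (isYes≗does; dec-true; dec-false; does-⇔; toWitness)
open import Relation.Binary.PropositionalEquality
  using (_≡_; _≢_; _≗_; refl; sym; trans; cong; cong₂; module ≡-Reasoning)

open ≡-Reasoning
open CommutativeSemigroupProperties
  (CommutativeRing.+-commutativeSemigroup xor-∧-commutativeRing) using (interchange)

xor-cancelˡ : ∀ x y → x xor (x xor y) ≡ y
xor-cancelˡ x y = trans (sym (xor-assoc x x y)) (cong (_xor y) (xor-same x))

∨-true : ∀ {x y} → x ∨ y ≡ true → x ≡ true ⊎ y ≡ true
∨-true {true}  _ = inj₁ refl
∨-true {false} h = inj₂ h

module _ {A : Set} where

  isYes-true : (a? : Dec A) → A → ⌊ a? ⌋ ≡ true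
  isYes-true a? a = trans (isYes≗does a?) (dec-true a? a)

  isYes-false : (a? : Dec A) → ¬ A → ⌊ a? ⌋ ≡ false
  isYes-false a? ¬a = trans (isYes≗does a?) (dec-false a? ¬a)

  isYes-sound : (a? : Dec A) → ⌊ a? ⌋ ≡ true → A
  isYes-sound a? h = toWitness (Equivalence.from T-≡ h)

  isYes-⇔ : ∀ {B : Set} → A ⇔ B → (a? : Dec A) (b? : Dec B) → ⌊ a? ⌋ ≡ ⌊ b? ⌋
  isYes-⇔ A⇔B a? b? = trans (isYes≗does a?) (trans (does-⇔ A⇔B a? b?) (sym (isYes≗does b?)))

%-cancelʳ-+ : ∀ a b c n .{{_ : NonZero n}} → (a + c) % n ≡ (b + c) % n → a % n ≡ b % n
%-cancelʳ-+ a b c (suc k) same =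
  trans (shift a) (trans (cong (λ r → (r + c * k % suc k) % suc k) same) (sym (shift b)))
  where
  shift : ∀ x → x % suc k ≡ ((x + c) % suc k + c * k % suc k) % suc k
  shift x = begin
    x % suc k                                 ≡⟨ sym ([m+kn]%n≡m%n x c (suc k)) ⟩
    (x + c * suc k) % suc k                   ≡⟨ cong (λ y → (x + y) % suc k) (*-suc c k) ⟩
    (x + (c + c * k)) % suc k                 ≡⟨ cong (_% suc k) (sym (+-assoc x c (c * k))) ⟩
    (x + c + c * k) % suc k                   ≡⟨ %-distribˡ-+ (x + c) (c * k) (suc k) ⟩
    ((x + c) % suc k + c * k % suc k) % suc k ∎

bit : Bool → ℕ
bit b = if b then 1 else 0

bit-injective : ∀ {x y} → bit x ≡ bit y → x ≡ y
bit-injective {false} {false} _ = refl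
bit-injective {true}  {true}  _ = refl

bit-xor-%2 : ∀ x y → (bit x % 2 + bit y) % 2 ≡ bit (x xor y)
bit-xor-%2 false false = refl
bit-xor-%2 false true  = refl
bit-xor-%2 true  false = refl
bit-xor-%2 true  true  = refl

parity : ∀ {m} → (Fin m → Bool) → Bool
parity {zero}  f = false
parity {suc m} f = f zero xor parity (f ∘ suc)

parity-cong : ∀ {m} {f g : Fin m → Bool} → f ≗ g → parity f ≡ parity g
parity-cong {zero}  f≗g = refl
parity-cong {suc m} f≗g = cong₂ _xor_ (f≗g zero) (parity-cong (f≗g ∘ suc))

parity-xor : ∀ {m} (f g : Fin m → Bool) → parity (λ i → f i xor g i) ≡ parity f xor parity g
parity-xor {zero}  f g = refl
parity-xor {suc m} f g = trans (cong ((f zero xor g zero) xor_) (parity-xor (f ∘ suc) (g ∘ suc)))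
                               (interchange (f zero) (g zero) _ _)

count-cong : ∀ {m} {f g : Fin m → Bool} → f ≗ g → count f ≡ count g
count-cong {zero}  f≗g = refl
count-cong {suc m} f≗g = cong₂ _+_ (cong bit (f≗g zero)) (count-cong (f≗g ∘ suc))

count-none : ∀ {m} {f : Fin m → Bool} → (∀ i → f i ≡ false) → count f ≡ 0
count-none {zero}          none = refl
count-none {suc m} {f} none rewrite none zero = count-none (none ∘ suc)

count-unique : ∀ {m} {f : Fin m → Bool} (i₀ : Fin m) → f i₀ ≡ true
             → (∀ i → f i ≡ true → i ≡ i₀) → count f ≡ 1
count-unique {suc m} {f} zero hit unique rewrite hit =
  cong suc (count-none (λ i → ¬-not (λ h → 0≢1+n (sym (unique (suc i) h)))))
count-unique {suc m} {f} (suc i₀) hit unique rewrite ¬-not {f zero} (0≢1+n ∘ unique zero) =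
  count-unique i₀ hit (λ i h → suc-injective (unique (suc i) h))

count-++ : ∀ m {k} (f : Fin (m + k) → Bool)
         → count f ≡ count (λ i → f (i ↑ˡ k)) + count (λ j → f (m ↑ʳ j))
count-++ zero    f = refl
count-++ (suc m) f = trans (cong (bit (f zero) +_) (count-++ m (f ∘ suc)))
                           (sym (+-assoc (bit (f zero)) _ _))

count-one-of-two : ∀ {m} (sel cand : Fin m → Bool) {a b : Fin m}
                 → cand a ≡ true → cand b ≡ true → (∀ i → cand i ≡ true → i ≡ a ⊎ i ≡ b)
                 → sel b ≡ not (sel a) → count (λ i → sel i ∧ cand i) ≡ 1
count-one-of-two sel cand {a} {b} at-a at-b only flip with sel a in sel-a
... | true  = count-unique a (trans (cong (_∧ cand a) sel-a) at-a) λ i h →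
  case only i (∧-conicalʳ _ _ h) of λ where
    (inj₁ i≡a) → i≡a
    (inj₂ refl) → case trans (sym (∧-conicalˡ _ _ h)) flip of λ ()
... | false = count-unique b (trans (cong (_∧ cand b) flip) at-b) λ i h →
  case only i (∧-conicalʳ _ _ h) of λ where
    (inj₁ refl) → case trans (sym (∧-conicalˡ _ _ h)) sel-a of λ ()
    (inj₂ i≡b) → i≡b

count-%2 : ∀ {m} (f : Fin m → Bool) → count f % 2 ≡ bit (parity f)
count-%2 {zero}  f = refl
count-%2 {suc m} f = begin
  (bit (f zero) + count (f ∘ suc)) % 2           ≡⟨ %-distribˡ-+ (bit (f zero)) (count (f ∘ suc)) 2 ⟩
  (bit (f zero) % 2 + count (f ∘ suc) % 2) % 2   ≡⟨ cong (λ r → (bit (f zero) % 2 + r) % 2) (count-%2 (f ∘ suc)) ⟩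
  (bit (f zero) % 2 + bit (parity (f ∘ suc))) % 2 ≡⟨ bit-xor-%2 (f zero) (parity (f ∘ suc)) ⟩
  bit (parity f)                                  ∎

parity-even : ∀ {m} {f : Fin m → Bool} → count f % 2 ≡ 0 → parity f ≡ false
parity-even {f = f} even = bit-injective (trans (sym (count-%2 f)) even)

parity-odd : ∀ {m} {f : Fin m → Bool} → count f % 2 ≡ 1 → parity f ≡ true
parity-odd {f = f} odd = bit-injective (trans (sym (count-%2 f)) odd)

parity-single : ∀ {m} (j : Fin (suc m)) → parity (single j) ≡ true
parity-single j = parity-odd {f = single j} (cong (_% 2)
  (count-unique j (isYes-true (j ≟ j) refl) (λ i → isYes-sound (i ≟ j))))

parity-xor-single : ∀ {m} (j : Fin (suc m)) (f : Fin (suc m) → Bool)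
                  → parity (λ i → single j i xor f i) ≡ not (parity f)
parity-xor-single j f = trans (parity-xor (single j) f) (cong (_xor parity f) (parity-single j))

prefixXor : ∀ {m} → Bool → (Fin m → Bool) → Fin (suc m) → Bool
prefixXor         a Z zero    = a
prefixXor {suc m} a Z (suc k) = prefixXor (a xor Z zero) (Z ∘ suc) k

prefixXor-step : ∀ {m} a (Z : Fin m → Bool) j → prefixXor a Z (inject₁ j) xor prefixXor a Z (suc j) ≡ Z j
prefixXor-step a Z zero    = xor-cancelˡ a (Z zero)
prefixXor-step a Z (suc j) = prefixXor-step (a xor Z zero) (Z ∘ suc) j

prefixXor-fromℕ : ∀ {m} a (Z : Fin m → Bool) → prefixXor a Z (fromℕ m) ≡ a xor parity Z
prefixXor-fromℕ {zero}  a Z = sym (xor-identityʳ a)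
prefixXor-fromℕ {suc m} a Z = trans (prefixXor-fromℕ (a xor Z zero) (Z ∘ suc))
                                    (xor-assoc a (Z zero) (parity (Z ∘ suc)))

alternating : ∀ {m} → Fin m → Bool
alternating zero    = false
alternating (suc i) = not (alternating i)

alternating-inject₁ : ∀ {m} (i : Fin m) → alternating (inject₁ i) ≡ alternating i
alternating-inject₁ zero    = refl
alternating-inject₁ (suc i) = cong not (alternating-inject₁ i)

alternating-fromℕ : ∀ n → suc n % 2 ≡ 1 → alternating (fromℕ n) ≡ false
alternating-fromℕ zero          _   = refl
alternating-fromℕ (suc zero)    ()
alternating-fromℕ (suc (suc n)) odd = trans (not-involutive _) (alternating-fromℕ n odd)

lastOr-inject₁ : ∀ {l} (k : Fin l) → lastOr (inject₁ k) ≡ inj₁ k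
lastOr-inject₁ {suc l} zero = refl
lastOr-inject₁ {suc l} (suc k) rewrite lastOr-inject₁ k = refl

lastOr-fromℕ : ∀ l → lastOr (fromℕ l) ≡ inj₂ tt
lastOr-fromℕ zero = refl
lastOr-fromℕ (suc l) rewrite lastOr-fromℕ l = refl

data SplitView (m k : ℕ) : Fin (m + k) → Set where
  left  : (i : Fin m) → SplitView m k (i ↑ˡ k)
  right : (j : Fin k) → SplitView m k (m ↑ʳ j)

splitView : ∀ m {k} (i : Fin (m + k)) → SplitView m k i
splitView zero    i       = right i
splitView (suc m) zero    = left zero
splitView (suc m) (suc i) with splitView m i
... | left i′ = left (suc i′)
... | right j = right j

↑ˡ≢↑ʳ : ∀ {m k} (i : Fin m) (j : Fin k) → i ↑ˡ k ≢ m ↑ʳ j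
↑ˡ≢↑ʳ {m} {k} i j eq with trans (sym (splitAt-↑ˡ m i k)) (trans (cong (splitAt m) eq) (splitAt-↑ʳ m k j))
... | ()

incident-≡ : ∀ H {e a b} w → ends H e ≡ (a , b) → incident H w e ≡ (⌊ a ≟ w ⌋ ∨ ⌊ b ≟ w ⌋)
incident-≡ H w = cong (λ ab → ⌊ proj₁ ab ≟ w ⌋ ∨ ⌊ proj₂ ab ≟ w ⌋)

cut-≡ : ∀ H (U : VertexSet H) {e a b} → ends H e ≡ (a , b) → cut H U e ≡ (U a xor U b)
cut-≡ H U = cong (λ ab → U (proj₁ ab) xor U (proj₂ ab))

Equiv-respʳ : ∀ {H} {X Y Z : EdgeSet H} → Y ≗ Z → Equiv H X Y → Equiv H X Z
Equiv-respʳ {H} Y≗Z (U , X∼Y) = U , λ e → trans (X∼Y e) (cong (_xor cut H U e) (Y≗Z e))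

module Glued (G' : Graph) (v₁ v₂ : Fin (nV G')) (l : ℕ) where

  private
    n = nV G'
    m = nE G'

  G : Graph
  G = glue G' v₁ v₂ l

  pos : Fin (suc (suc l)) → Fin (n + l)
  pos = pathVtx n l v₁ v₂

  join : EdgeSet G' → (Fin (suc l) → Bool) → EdgeSet G
  join = joinE G' v₁ v₂ l

  extendV : VertexSet G' → (Fin l → Bool) → VertexSet G
  extendV U' W v = [ U' , W ] (splitAt n v)

  pos-inner : ∀ k → pos (suc (inject₁ k)) ≡ n ↑ʳ k
  pos-inner k = cong [ n ↑ʳ_ , (λ _ → v₂ ↑ˡ l) ] (lastOr-inject₁ k)

  pos-last : pos (fromℕ (suc l)) ≡ v₂ ↑ˡ l
  pos-last = cong [ n ↑ʳ_ , (λ _ → v₂ ↑ˡ l) ] (lastOr-fromℕ l)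

  pos-↑ˡ : ∀ p {x} → pos p ≡ x ↑ˡ l → p ≡ zero ⊎ p ≡ fromℕ (suc l)
  pos-↑ˡ zero    _ = inj₁ refl
  pos-↑ˡ (suc i) {x} h with view i
  ... | ‵fromℕ     = inj₂ refl
  ... | ‵inject₁ k = ⊥-elim (↑ˡ≢↑ʳ x k (trans (sym h) (pos-inner k)))

  pos-↑ʳ : ∀ p {k} → pos p ≡ n ↑ʳ k → p ≡ suc (inject₁ k)
  pos-↑ʳ zero    {k} h = ⊥-elim (↑ˡ≢↑ʳ v₁ k h)
  pos-↑ʳ (suc i) {k} h with view i
  ... | ‵fromℕ      = ⊥-elim (↑ˡ≢↑ʳ v₂ k (trans (sym pos-last) h))
  ... | ‵inject₁ k′ = cong (suc ∘ inject₁) (↑ʳ-injective n k′ k (trans (sym (pos-inner k′)) h))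

  ends-↑ˡ : ∀ e → ends G (e ↑ˡ suc l) ≡ (proj₁ (ends G' e) ↑ˡ l , proj₂ (ends G' e) ↑ˡ l)
  ends-↑ˡ e rewrite splitAt-↑ˡ m e (suc l) = refl

  ends-↑ʳ : ∀ j → ends G (m ↑ʳ j) ≡ (pos (inject₁ j) , pos (suc j))
  ends-↑ʳ j rewrite splitAt-↑ʳ m (suc l) j = refl

  join-↑ˡ : ∀ {X' X₀} e → join X' X₀ (e ↑ˡ suc l) ≡ X' e
  join-↑ˡ e rewrite splitAt-↑ˡ m e (suc l) = refl

  join-↑ʳ : ∀ {X' X₀} j → join X' X₀ (m ↑ʳ j) ≡ X₀ j
  join-↑ʳ j rewrite splitAt-↑ʳ m (suc l) j = refl

  join-const : ∀ b → join (λ _ → b) (λ _ → b) ≗ (λ _ → b)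
  join-const b e with splitView m e
  ... | left e′ = join-↑ˡ e′
  ... | right j = join-↑ʳ j

  extendV-↑ˡ : ∀ {U' W} x → extendV U' W (x ↑ˡ l) ≡ U' x
  extendV-↑ˡ x rewrite splitAt-↑ˡ n x l = refl

  extendV-↑ʳ : ∀ {U' W} k → extendV U' W (n ↑ʳ k) ≡ W k
  extendV-↑ʳ k rewrite splitAt-↑ʳ n l k = refl

  extendV-pos : ∀ U' (f : Fin (suc (suc l)) → Bool) → U' v₁ ≡ f zero → U' v₂ ≡ f (fromℕ (suc l))
              → ∀ p → extendV U' (f ∘ suc ∘ inject₁) (pos p) ≡ f p
  extendV-pos U' f first last zero = trans (extendV-↑ˡ v₁) first
  extendV-pos U' f first last (suc i) with view i
  ... | ‵fromℕ     = trans (cong (extendV U' _) pos-last) (trans (extendV-↑ˡ v₂) last)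
  ... | ‵inject₁ k = trans (cong (extendV U' _) (pos-inner k)) (extendV-↑ʳ k)

  cut-↑ˡ : ∀ U e → cut G U (e ↑ˡ suc l) ≡ cut G' (λ x → U (x ↑ˡ l)) e
  cut-↑ˡ U e = cut-≡ G U (ends-↑ˡ e)

  cut-↑ʳ : ∀ U j → cut G U (m ↑ʳ j) ≡ (U (pos (inject₁ j)) xor U (pos (suc j)))
  cut-↑ʳ U j = cut-≡ G U (ends-↑ʳ j)

  join-∼ : ∀ {X' Y' X₀ Y₀} (U' : VertexSet G') → (∀ e → X' e ≡ (Y' e xor cut G' U' e))
         → U' v₂ ≡ U' v₁ xor parity (λ j → Y₀ j xor X₀ j)
         → Equiv G (join X' X₀) (join Y' Y₀)
  join-∼ {X'} {Y'} {X₀} {Y₀} U' X'∼Y' ends-agree = U , λ e → agree e (splitView m e)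
    where
    label : Fin (suc (suc l)) → Bool
    label = prefixXor (U' v₁) (λ j → Y₀ j xor X₀ j)

    U : VertexSet G
    U = extendV U' (label ∘ suc ∘ inject₁)

    U-pos : ∀ p → U (pos p) ≡ label p
    U-pos = extendV-pos U' label refl (trans ends-agree (sym (prefixXor-fromℕ (U' v₁) (λ j → Y₀ j xor X₀ j))))

    agree : ∀ e → SplitView m (suc l) e → join X' X₀ e ≡ (join Y' Y₀ e xor cut G U e)
    agree _ (left e) = begin
      join X' X₀ (e ↑ˡ suc l)                            ≡⟨ join-↑ˡ e ⟩
      X' e                                               ≡⟨ X'∼Y' e ⟩
      Y' e xor cut G' U' e                               ≡⟨ cong₂ _xor_ (sym (join-↑ˡ e)) (sym cut-G') ⟩
      join Y' Y₀ (e ↑ˡ suc l) xor cut G U (e ↑ˡ suc l)   ∎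
      where
      cut-G' : cut G U (e ↑ˡ suc l) ≡ cut G' U' e
      cut-G' = trans (cut-↑ˡ U e) (cong₂ _xor_ (extendV-↑ˡ _) (extendV-↑ˡ _))
    agree _ (right j) = begin
      join X' X₀ (m ↑ʳ j)                          ≡⟨ join-↑ʳ j ⟩
      X₀ j                                         ≡⟨ sym (xor-cancelˡ (Y₀ j) (X₀ j)) ⟩
      Y₀ j xor (Y₀ j xor X₀ j)                     ≡⟨ cong₂ _xor_ (sym (join-↑ʳ j)) (sym cut-path) ⟩
      join Y' Y₀ (m ↑ʳ j) xor cut G U (m ↑ʳ j)     ∎
      where
      cut-path : cut G U (m ↑ʳ j) ≡ (Y₀ j xor X₀ j)
      cut-path = trans (cut-↑ʳ U j)
        (trans (cong₂ _xor_ (U-pos (inject₁ j)) (U-pos (suc j))) (prefixXor-step _ _ j))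

  join-∼-or-flipped : ∀ {X' Y' X₀} (W₀ : Fin (suc l) → Bool) → Equiv G' X' Y'
    → Equiv G (join X' X₀) (join Y' W₀)
      ⊎ (∀ j → Equiv G (join X' X₀) (join Y' (λ i → W₀ i xor single j i)))
  join-∼-or-flipped {X₀ = X₀} W₀ (U' , X'∼Y') with U' v₂ Bool.≟ U' v₁ xor parity (λ i → W₀ i xor X₀ i)
  ... | yes ends-agree   = inj₁ (join-∼ U' X'∼Y' ends-agree)
  ... | no ends-disagree = inj₂ λ j → join-∼ U' X'∼Y' (begin
    U' v₂                                          ≡⟨ ¬-not ends-disagree ⟩
    not (U' v₁ xor p)                              ≡⟨ not-distribʳ-xor (U' v₁) p ⟩
    U' v₁ xor not p                                ≡⟨ cong (U' v₁ xor_) (sym (flipped j)) ⟩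
    U' v₁ xor parity (λ i → (W₀ i xor single j i) xor X₀ i) ∎)
    where
    p = parity (λ i → W₀ i xor X₀ i)
    flipped : ∀ j → parity (λ i → (W₀ i xor single j i) xor X₀ i) ≡ not p
    flipped j = trans
      (parity-cong λ i → trans (cong (_xor X₀ i) (xor-comm (W₀ i) (single j i))) (xor-assoc (single j i) (W₀ i) (X₀ i)))
      (parity-xor-single j (λ i → W₀ i xor X₀ i))

  ∼-restrict : ∀ {X' X₀} {Y : EdgeSet G} {Y' : EdgeSet G'} → (∀ e → Y (e ↑ˡ suc l) ≡ Y' e)
             → Equiv G (join X' X₀) Y → Equiv G' X' Y'
  ∼-restrict {X'} {X₀} {Y} {Y'} Y↾ (U , X∼Y) = (λ x → U (x ↑ˡ l)) , λ e → begin
    X' e                                       ≡⟨ sym (join-↑ˡ e) ⟩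
    join X' X₀ (e ↑ˡ suc l)                    ≡⟨ X∼Y (e ↑ˡ suc l) ⟩
    Y (e ↑ˡ suc l) xor cut G U (e ↑ˡ suc l)    ≡⟨ cong₂ _xor_ (Y↾ e) (cut-↑ˡ U e) ⟩
    Y' e xor cut G' (λ x → U (x ↑ˡ l)) e       ∎

  incident-path : ∀ w j → incident G w (m ↑ʳ j) ≡ (⌊ pos (inject₁ j) ≟ w ⌋ ∨ ⌊ pos (suc j) ≟ w ⌋)
  incident-path w j = incident-≡ G w (ends-↑ʳ j)

  incident-↑ˡ-↑ˡ : ∀ x e → incident G (x ↑ˡ l) (e ↑ˡ suc l) ≡ incident G' x e
  incident-↑ˡ-↑ˡ x e = trans (incident-≡ G _ (ends-↑ˡ e)) (cong₂ _∨_ (same (proj₁ (ends G' e))) (same (proj₂ (ends G' e))))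
    where
    same : ∀ a → ⌊ a ↑ˡ l ≟ x ↑ˡ l ⌋ ≡ ⌊ a ≟ x ⌋
    same a = isYes-⇔ (mk⇔ (↑ˡ-injective l a x) (cong (_↑ˡ l))) _ _

  incident-↑ʳ-↑ˡ : ∀ k e → incident G (n ↑ʳ k) (e ↑ˡ suc l) ≡ false
  incident-↑ʳ-↑ˡ k e = trans (incident-≡ G _ (ends-↑ˡ e))
    (cong₂ _∨_ (isYes-false (proj₁ (ends G' e) ↑ˡ l ≟ n ↑ʳ k) (↑ˡ≢↑ʳ _ k))
               (isYes-false (proj₂ (ends G' e) ↑ˡ l ≟ n ↑ʳ k) (↑ˡ≢↑ʳ _ k)))

  incident-inner : ∀ k j → incident G (n ↑ʳ k) (m ↑ʳ j) ≡ true → j ≡ inject₁ k ⊎ j ≡ suc k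
  incident-inner k j h with ∨-true {⌊ pos (inject₁ j) ≟ n ↑ʳ k ⌋} (trans (sym (incident-path (n ↑ʳ k) j)) h)
  ... | inj₁ at-left  = inj₂ (inject₁-injective (pos-↑ʳ (inject₁ j) (isYes-sound (pos (inject₁ j) ≟ n ↑ʳ k) at-left)))
  ... | inj₂ at-right = inj₁ (suc-injective (pos-↑ʳ (suc j) (isYes-sound (pos (suc j) ≟ n ↑ʳ k) at-right)))

  incident-before : ∀ k → incident G (n ↑ʳ k) (m ↑ʳ inject₁ k) ≡ true
  incident-before k = trans (incident-path _ (inject₁ k))
    (trans (cong (⌊ pos (inject₁ (inject₁ k)) ≟ n ↑ʳ k ⌋ ∨_) (isYes-true (pos (suc (inject₁ k)) ≟ n ↑ʳ k) (pos-inner k))) (∨-zeroʳ _))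

  incident-after : ∀ k → incident G (n ↑ʳ k) (m ↑ʳ suc k) ≡ true
  incident-after k = trans (incident-path _ (suc k))
    (cong (_∨ ⌊ pos (suc (suc k)) ≟ n ↑ʳ k ⌋) (isYes-true (pos (suc (inject₁ k)) ≟ n ↑ʳ k) (pos-inner k)))

  alternating-avoids-↑ˡ : suc l % 2 ≡ 1 → ∀ x j → (alternating j ∧ incident G (x ↑ˡ l) (m ↑ʳ j)) ≡ false
  alternating-avoids-↑ˡ l-even x j with alternating j in chosen
  ... | false = refl
  ... | true  = trans (incident-path _ j) (cong₂ _∨_ (isYes-false (pos (inject₁ j) ≟ x ↑ˡ l) first)
                                                  (isYes-false (pos (suc j) ≟ x ↑ˡ l) second))
    where
    first : pos (inject₁ j) ≢ x ↑ˡ l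
    first h with pos-↑ˡ (inject₁ j) h
    ... | inj₁ j≡0 = case trans (sym chosen) (cong alternating (inject₁-injective {j = zero} j≡0)) of λ ()
    ... | inj₂ j≡last = fromℕ≢inject₁ (sym j≡last)
    second : pos (suc j) ≢ x ↑ˡ l
    second h with pos-↑ˡ (suc j) h
    ... | inj₁ ()
    ... | inj₂ j≡last = case trans (sym chosen)
            (trans (cong alternating (suc-injective j≡last)) (alternating-fromℕ l l-even)) of λ ()

  extend-perfect : ∀ {M} → suc l % 2 ≡ 1 → IsPerfectMatching G' M → IsPerfectMatching G (join M alternating)
  extend-perfect {M} l-even M-perfect w = covered w (splitView n w)
    where
    covered : ∀ w → SplitView n l w → count (λ e → join M alternating e ∧ incident G w e) ≡ 1
    covered _ (left x) = begin
      count (λ e → join M alternating e ∧ incident G (x ↑ˡ l) e)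
        ≡⟨ count-++ m _ ⟩
      count (λ e → join M alternating (e ↑ˡ suc l) ∧ incident G (x ↑ˡ l) (e ↑ˡ suc l))
        + count (λ j → join M alternating (m ↑ʳ j) ∧ incident G (x ↑ˡ l) (m ↑ʳ j))
        ≡⟨ cong₂ _+_ (count-cong λ e → cong₂ _∧_ (join-↑ˡ {M} {alternating} e) (incident-↑ˡ-↑ˡ x e))
                     (count-none λ j → trans (cong (_∧ incident G (x ↑ˡ l) (m ↑ʳ j)) (join-↑ʳ {M} {alternating} j))
                                             (alternating-avoids-↑ˡ l-even x j)) ⟩
      count (λ e → M e ∧ incident G' x e) + 0
        ≡⟨ trans (+-identityʳ _) (M-perfect x) ⟩
      1 ∎
    covered _ (right k) = begin
      count (λ e → join M alternating e ∧ incident G (n ↑ʳ k) e)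
        ≡⟨ count-++ m _ ⟩
      count (λ e → join M alternating (e ↑ˡ suc l) ∧ incident G (n ↑ʳ k) (e ↑ˡ suc l))
        + count (λ j → join M alternating (m ↑ʳ j) ∧ incident G (n ↑ʳ k) (m ↑ʳ j))
        ≡⟨ cong₂ _+_ (count-none λ e → trans (cong (join M alternating (e ↑ˡ suc l) ∧_) (incident-↑ʳ-↑ˡ k e))
                                             (∧-zeroʳ _))
                     (count-cong λ j → cong (_∧ incident G (n ↑ʳ k) (m ↑ʳ j)) (join-↑ʳ {M} {alternating} j)) ⟩
      count (λ j → alternating j ∧ incident G (n ↑ʳ k) (m ↑ʳ j))
        ≡⟨ count-one-of-two alternating _ (incident-before k) (incident-after k) (incident-inner k)
                            (cong not (sym (alternating-inject₁ k))) ⟩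
      1 ∎

  count-join-∧ : ∀ A A₀ B B₀ → count (λ e → join A A₀ e ∧ join B B₀ e)
                              ≡ count (λ e → A e ∧ B e) + count (λ j → A₀ j ∧ B₀ j)
  count-join-∧ A A₀ B B₀ = trans (count-++ m _) (cong₂ _+_
    (count-cong λ e → cong₂ _∧_ (join-↑ˡ {A} {A₀} e) (join-↑ˡ {B} {B₀} e))
    (count-cong λ j → cong₂ _∧_ (join-↑ʳ {A} {A₀} j) (join-↑ʳ {B} {B₀} j)))

  nonFeasible-restrict : ∀ {X' X₀} → suc l % 2 ≡ 1 → NonFeasible G (join X' X₀) → NonFeasible G' X'
  nonFeasible-restrict {X'} {X₀} l-even nonFeasible (M₁ , M₂ , M₁-perfect , M₂-perfect , differ) =
    nonFeasible ( join M₁ alternating , join M₂ alternating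
                , extend-perfect l-even M₁-perfect , extend-perfect l-even M₂-perfect
                , λ same → differ (%-cancelʳ-+ (count (λ e → M₁ e ∧ X' e)) (count (λ e → M₂ e ∧ X' e))
                                                (count (λ j → alternating j ∧ X₀ j)) 2
                    (trans (cong (_% 2) (sym (count-join-∧ M₁ alternating X' X₀)))
                      (trans same (cong (_% 2) (count-join-∧ M₂ alternating X' X₀))))))

lemma2p4 : (G' : Graph) → Loopless G' → Connected G'
    → (v₁ v₂ : Fin (nV G')) → v₁ ≢ v₂
    → (l : ℕ) → (X₀ : Fin (suc l) → Bool) → (X' : EdgeSet G')
    → let G = glue G' v₁ v₂ l
          X = joinE G' v₁ v₂ l X' X₀
      in ((suc l % 2 ≡ 1 → NonFeasible G X → NonFeasible G' X')
         × (count X₀ % 2 ≡ 0 → Equiv G X (joinE G' v₁ v₂ l X' (λ _ → false)))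
         × (count X₀ % 2 ≡ 1 → ∀ j → Equiv G X (joinE G' v₁ v₂ l X' (single j)))
         × (∀ Y → Equiv G' X' Y → ∃[ Y₀ ] Equiv G X (joinE G' v₁ v₂ l Y Y₀))
         × (Equiv G' X' (∅ G') → Equiv G X (∅ G) ⊎ (∀ j → Equiv G X (joinE G' v₁ v₂ l (∅ G') (single j))))
         × (Equiv G' X' (allE G') → Equiv G X (allE G)
              ⊎ (∀ j → Equiv G X (joinE G' v₁ v₂ l (allE G') (λ i → not (single j i)))))
         × ((Equiv G X (∅ G) → Equiv G' X' (∅ G'))
           × (Equiv G X (allE G) → Equiv G' X' (allE G'))))
lemma2p4 G' _ _ v₁ v₂ _ l X₀ X' =
    nonFeasible-restrict
  , (λ even → join-∼ (λ _ → false) X'∼X' (sym (parity-even {f = X₀} even)))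
  , (λ odd j → join-∼ (λ _ → false) X'∼X'
                 (sym (trans (parity-xor-single j X₀) (cong not (parity-odd {f = X₀} odd)))))
  , lift
  , (λ X'∼∅ → map₁ (Equiv-respʳ (join-const false)) (join-∼-or-flipped (λ _ → false) X'∼∅))
  , (λ X'∼E → map₁ (Equiv-respʳ (join-const true)) (join-∼-or-flipped (λ _ → true) X'∼E))
  , ∼-restrict {Y = ∅ G} (λ _ → refl)
  , ∼-restrict {Y = allE G} (λ _ → refl)
  where
  open Glued G' v₁ v₂ l

  X'∼X' : ∀ e → X' e ≡ (X' e xor cut G' (λ _ → false) e)
  X'∼X' e = sym (xor-identityʳ (X' e))

  lift : ∀ Y → Equiv G' X' Y → ∃[ Y₀ ] Equiv G (join X' X₀) (join Y Y₀)
  lift Y X'∼Y with join-∼-or-flipped {X₀ = X₀} (λ _ → false) X'∼Y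
  ... | inj₁ same    = _ , same
  ... | inj₂ flipped = _ , flipped zero
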